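{- For every pair of integers $d\ge 1$ and $p\ge 0$, there exists a graph with pathwidth at most $p+2$ which contains a distance-$(4d-1)$ half graph of order $(2d+1)^p$.
   Context: All graphs are finite, undirected and simple; $\mathrm{dist}$ is the shortest-path distance. For integers $D,\ell\ge1$, $2\ell$ pairwise distinct vertices $a_1,\dots,a_\ell,b_1,\dots,b_\ell$ of a graph form a distance-$D$ half graph of order $\ell$ if for all $i,j\in[1,\ell]$ we have $\mathrm{dist}(b_i,a_j)\le D$ if and only if $i<j$. A path decomposition of $G$ is a sequence of vertex subsets (bags) such that every edge has both endpoints in some bag and each vertex appears in a contiguous set of bags; its width is the maximum bag size minus one, and the pathwidth of $G$ is the minimum width of a path decomposition of $G$. -}

module Defs where

open import Data.Nat using (ℕ; zero; suc; _+_; _≤_; _<_)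
open import Data.Bool using (Bool; true; false)
open import Data.Fin using (Fin)
open import Data.Fin.Subset using (Subset; _∈_; ∣_∣)
open import Data.Product using (Σ; ∃; ∃-syntax; _×_; _,_)
open import Relation.Binary.PropositionalEquality using (_≡_; _≢_)
open import Relation.Nullary using (¬_)
open import Function.Definitions using (Injective)

record Graph : Set where
  field
    n      : ℕ
    adj    : Fin n → Fin n → Bool
    sym    : ∀ u v → adj u v ≡ adj v u
    irrefl : ∀ u → adj u u ≡ false
open Graph public

Edge : (G : Graph) → Fin (n G) → Fin (n G) → Set
Edge G u v = adj G u v ≡ true

data Walk (G : Graph) : Fin (n G) → Fin (n G) → ℕ → Set where
  here : ∀ {u} → Walk G u u zero
  step : ∀ {u w v k} → Edge G u w → Walk G w v k → Walk G u v (suc k)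

-- dist(u,v) ≤ D : there is a walk (equivalently a path) of length at most D.
DistLe : (G : Graph) → ℕ → Fin (n G) → Fin (n G) → Set
DistLe G D u v = ∃[ k ] (k ≤ D × Walk G u v k)

-- Distance-D half graph of order ℓ, indices i ∈ [1,ℓ] represented by Fin ℓ.
-- a i = a_{i+1}, b i = b_{i+1}.
record HalfGraph (G : Graph) (D ℓ : ℕ) : Set where
  field
    a : Fin ℓ → Fin (n G)
    b : Fin ℓ → Fin (n G)
    a-inj    : Injective _≡_ _≡_ a
    b-inj    : Injective _≡_ _≡_ b
    a≢b      : ∀ i j → a i ≢ b j
    half     : ∀ i j → (DistLe G D (b i) (a j) → Data.Fin._<_ i j)
                     × (Data.Fin._<_ i j → DistLe G D (b i) (a j))

record PathDecomposition (G : Graph) : Set where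
  field
    m       : ℕ
    bag     : Fin m → Subset (n G)
    covers-vertex : ∀ v → ∃[ t ] (v ∈ bag t)
    covers-edge   : ∀ u v → Edge G u v → ∃[ t ] (u ∈ bag t × v ∈ bag t)
    contiguous    : ∀ v (s t r : Fin m) → Data.Fin._≤_ s t → Data.Fin._≤_ t r →
                    v ∈ bag s → v ∈ bag r → v ∈ bag t

-- width = max bag size - 1; width ≤ k  iff every bag has at most k+1 vertices.
WidthLe : {G : Graph} → PathDecomposition G → ℕ → Set
WidthLe P k = ∀ t → ∣ PathDecomposition.bag P t ∣ ≤ suc k

PathwidthLe : Graph → ℕ → Set
PathwidthLe G k = Σ (PathDecomposition G) λ P → WidthLe P k

module Submission where

-- The half graph is indexed by the integers i < m ^ p, m = 2d + 1, read in base m.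
-- For every digit position j, the ends b_i and a_i are joined by arms of lengths
-- d + i_j and d + (2d - i_j) to a hub shared by all integers agreeing with i above
-- position j. If i < k and j is the highest digit where they differ, the two arms
-- meet at a common hub and form a walk of length 4d + i_j - k_j ≤ 4d - 1. If i ≥ k,
-- a potential changing by at most 1 along edges, 0 at b_i and 4d at a_k, shows that
-- b_i and a_k are at distance at least 4d. Order the vertices integer by integer,
-- each hub at the first integer of its block: then at most p + 2 earlier vertices
-- have a neighbour at or after any given vertex (one hub per level, the current end
-- vertex and the previous arm vertex), and vertex separation bounds the pathwidth.

open import Defs hiding (sym)
open import Data.Bool as Bool using (true)
open import Data.Empty using (⊥-elim)
open import Data.Fin as Fin using (Fin; toℕ)
import Data.Fin.Properties as Fin
open import Data.Fin.Subset as Subset using (Subset; ⁅_⁆; _∪_; inside; outside)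
import Data.Fin.Subset.Properties as Subset
open import Data.List using (List; []; _∷_; _++_; length; map; allFin)
import Data.List.Properties as List
open import Data.List.Membership.Propositional.Properties using (∈-map⁺; ∈-++⁺ˡ; ∈-++⁺ʳ; ∈-allFin)
open import Data.List.Membership.Propositional using () renaming (_∈_ to _∈ˡ_)
open import Data.List.Relation.Unary.Any using (here; there)
open import Data.Nat
  using (ℕ; zero; suc; _+_; _*_; _∸_; _^_; _⊓_; _≤_; _<_; z≤n; s≤s; NonZero; >-nonZero; >-nonZero⁻¹)
open import Data.Nat.DivMod
import Data.Nat.Properties as ℕ
open import Data.Nat.Tactic.RingSolver using (solve-∀)
open import Data.Product using (∃-syntax; _×_; _,_; proj₁; proj₂; uncurry)
open import Data.Sum using (_⊎_; inj₁; inj₂; swap)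
open import Data.Vec using ([]; _∷_; tabulate)
import Data.Vec.Properties as Vec
open import Function.Base using (_∘_)
open import Function.Bundles using (mk⇔)
open import Relation.Binary.Definitions using (tri<; tri≈; tri>)
open import Relation.Binary.PropositionalEquality
open import Relation.Nullary using (¬_; Dec; yes; no; does)
open import Relation.Nullary.Decidable using (map′; _⊎-dec_; _×-dec_; dec-true; dec-false; does-⇔)

-- Walks and potentials

module _ {G : Graph} where

  _++ʷ_ : ∀ {u v w k l} → Walk G u v k → Walk G v w l → Walk G u w (k + l)
  here       ++ʷ W′ = W′
  step e W   ++ʷ W′ = step e (W ++ʷ W′)

  Edge-sym : ∀ {u v} → Edge G u v → Edge G v u
  Edge-sym {u} {v} e = trans (Graph.sym G v u) e

  reverseʷ : ∀ {u v k} → Walk G u v k → Walk G v u k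
  reverseʷ here = here
  reverseʷ {k = suc k} (step e W) = subst (Walk G _ _) (ℕ.+-comm k 1) (reverseʷ W ++ʷ step (Edge-sym e) here)

Lipschitz : (G : Graph) → (Fin (n G) → ℕ) → Set
Lipschitz G φ = ∀ u v → Edge G u v → φ v ≤ suc (φ u)

module _ {G : Graph} {φ : Fin (n G) → ℕ} (φ-lip : Lipschitz G φ) where

  Lipschitz⇒walk-bound : ∀ {u v k} → Walk G u v k → φ v ≤ k + φ u
  Lipschitz⇒walk-bound here = ℕ.≤-refl
  Lipschitz⇒walk-bound {u} {k = suc k} (step {w = w} e W) = begin
    _                ≤⟨ Lipschitz⇒walk-bound W ⟩
    k + φ w          ≤⟨ ℕ.+-monoʳ-≤ k (φ-lip u w e) ⟩
    k + suc (φ u)    ≡⟨ ℕ.+-suc k (φ u) ⟩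
    suc k + φ u      ∎
    where open ℕ.≤-Reasoning

  Lipschitz⇒¬DistLe : ∀ {D u v} → D + φ u < φ v → ¬ DistLe G D u v
  Lipschitz⇒¬DistLe {u = u} far (k , k≤D , W) =
    ℕ.<⇒≱ far (ℕ.≤-trans (Lipschitz⇒walk-bound W) (ℕ.+-monoˡ-≤ (φ u) k≤D))

-- Pathwidth from a vertex ordering

dec-true⁻¹ : ∀ {A : Set} (a? : Dec A) → does a? ≡ true → A
dec-true⁻¹ (yes a) _ = a

module RelationGraph {V : Set} {N : ℕ} (decode : Fin N → V)
  (R : V → V → Set) (R? : ∀ a b → Dec (R a b)) (R-irrefl : ∀ a → ¬ R a a) where

  Linked : V → V → Set
  Linked a b = R a b ⊎ R b a

  linked? : ∀ a b → Dec (Linked a b)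
  linked? a b = R? a b ⊎-dec R? b a

  graph : Graph
  graph = record
    { n      = N
    ; adj    = λ u v → does (linked? (decode u) (decode v))
    ; sym    = λ u v → does-⇔ (mk⇔ swap swap) (linked? (decode u) (decode v)) (linked? (decode v) (decode u))
    ; irrefl = λ u → dec-false (linked? (decode u) (decode u)) λ where
        (inj₁ r) → R-irrefl _ r
        (inj₂ r) → R-irrefl _ r
    }

  Edge⇒Linked : ∀ {u v} → Edge graph u v → Linked (decode u) (decode v)
  Edge⇒Linked {u} {v} = dec-true⁻¹ (linked? (decode u) (decode v))

  Linked⇒Edge : ∀ {u v} → Linked (decode u) (decode v) → Edge graph u v
  Linked⇒Edge {u} {v} = dec-true (linked? (decode u) (decode v))

∣p∪q∣≤∣p∣+∣q∣ : ∀ {n} (p q : Subset n) → Subset.∣ p ∪ q ∣ ≤ Subset.∣ p ∣ + Subset.∣ q ∣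
∣p∪q∣≤∣p∣+∣q∣ []            []            = z≤n
∣p∪q∣≤∣p∣+∣q∣ (inside ∷ p)  (inside ∷ q)    =
  s≤s (ℕ.≤-trans (∣p∪q∣≤∣p∣+∣q∣ p q) (ℕ.+-monoʳ-≤ Subset.∣ p ∣ (ℕ.n≤1+n _)))
∣p∪q∣≤∣p∣+∣q∣ (inside ∷ p)  (outside ∷ q)   = s≤s (∣p∪q∣≤∣p∣+∣q∣ p q)
∣p∪q∣≤∣p∣+∣q∣ (outside ∷ p) (inside ∷ q)    =
  ℕ.≤-trans (s≤s (∣p∪q∣≤∣p∣+∣q∣ p q)) (ℕ.≤-reflexive (sym (ℕ.+-suc _ _)))
∣p∪q∣≤∣p∣+∣q∣ (outside ∷ p) (outside ∷ q)   = ∣p∪q∣≤∣p∣+∣q∣ p q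

fromList : ∀ {n} → List (Fin n) → Subset n
fromList []       = Subset.⊥
fromList (x ∷ xs) = ⁅ x ⁆ ∪ fromList xs

∣fromList∣≤length : ∀ {n} (xs : List (Fin n)) → Subset.∣ fromList xs ∣ ≤ length xs
∣fromList∣≤length {n} []  = ℕ.≤-reflexive (Subset.∣⊥∣≡0 n)
∣fromList∣≤length (x ∷ xs) = begin
  Subset.∣ ⁅ x ⁆ ∪ fromList xs ∣             ≤⟨ ∣p∪q∣≤∣p∣+∣q∣ ⁅ x ⁆ (fromList xs) ⟩
  Subset.∣ ⁅ x ⁆ ∣ + Subset.∣ fromList xs ∣  ≡⟨ cong (_+ _) (Subset.∣⁅x⁆∣≡1 x) ⟩
  suc Subset.∣ fromList xs ∣                 ≤⟨ s≤s (∣fromList∣≤length xs) ⟩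
  suc (length xs)                            ∎
  where open ℕ.≤-Reasoning

∈-fromList⁺ : ∀ {n} {x : Fin n} {xs} → x ∈ˡ xs → x Subset.∈ fromList xs
∈-fromList⁺ (here refl) = Subset.x∈p∪q⁺ (inj₁ (Subset.x∈⁅x⁆ _))
∈-fromList⁺ (there x∈xs) = Subset.x∈p∪q⁺ (inj₂ (∈-fromList⁺ x∈xs))

∣p∣≤length : ∀ {n} (p : Subset n) (xs : List (Fin n)) →
             (∀ {x} → x Subset.∈ p → x ∈ˡ xs) → Subset.∣ p ∣ ≤ length xs
∣p∣≤length p xs p⊆xs =
  ℕ.≤-trans (Subset.p⊆q⇒∣p∣≤∣q∣ (∈-fromList⁺ ∘ p⊆xs)) (∣fromList∣≤length xs)

module _ {n} {P : Fin n → Set} (P? : ∀ x → Dec (P x)) where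

  filterFin : Subset n
  filterFin = tabulate (λ x → does (P? x))

  ∈-filterFin⁺ : ∀ {x} → P x → x Subset.∈ filterFin
  ∈-filterFin⁺ {x} px = Vec.lookup⇒[]= x filterFin (trans (Vec.lookup∘tabulate _ x) (dec-true (P? x) px))

  ∈-filterFin⁻ : ∀ {x} → x Subset.∈ filterFin → P x
  ∈-filterFin⁻ {x} x∈ = dec-true⁻¹ (P? x) (trans (sym (Vec.lookup∘tabulate _ x)) (Vec.[]=⇒lookup x∈))

toℕ-suc⇒≡pred : ∀ {n} {u t : Fin n} → suc (toℕ u) ≡ toℕ t → u ≡ Fin.pred t
toℕ-suc⇒≡pred {t = Fin.suc t} 1+u≡1+t =
  Fin.toℕ-injective (trans (ℕ.suc-injective 1+u≡1+t) (sym (Fin.toℕ-inject₁ t)))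

module VertexSeparation (G : Graph) where

  private
    V = Fin (n G)

  Active : V → V → Set
  Active t u = ∃[ w ] (t Fin.≤ w × Edge G u w)

  InBag : V → V → Set
  InBag t u = u ≡ t ⊎ (u Fin.< t × Active t u)

  inBag? : ∀ t u → Dec (InBag t u)
  inBag? t u = (u Fin.≟ t) ⊎-dec ((u Fin.<? t) ×-dec Fin.any? λ w → (t Fin.≤? w) ×-dec (adj G u w Bool.≟ true))

  InBag⇒≤ : ∀ {t u} → InBag t u → u Fin.≤ t
  InBag⇒≤ (inj₁ refl)       = Fin.≤-refl
  InBag⇒≤ (inj₂ (u<t , _)) = ℕ.<⇒≤ u<t

  InBag-contiguous : ∀ {s t r v} → s Fin.≤ t → t Fin.≤ r → InBag s v → InBag r v → InBag t v
  InBag-contiguous s≤t t≤r v∈s (inj₁ refl) = inj₁ (Fin.≤-antisym (Fin.≤-trans (InBag⇒≤ v∈s) s≤t) t≤r)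
  InBag-contiguous {t = t} {v = v} s≤t t≤r v∈s (inj₂ (_ , w , r≤w , e)) with v Fin.≟ t
  ... | yes v≡t = inj₁ v≡t
  ... | no v≢t  = inj₂ (Fin.≤∧≢⇒< (Fin.≤-trans (InBag⇒≤ v∈s) s≤t) v≢t , w , Fin.≤-trans t≤r r≤w , e)

  covers-edge : ∀ u v → Edge G u v → ∃[ t ] (InBag t u × InBag t v)
  covers-edge u v e with Fin.<-cmp u v
  ... | tri< u<v _ _ = v , inj₂ (u<v , v , Fin.≤-refl , e) , inj₁ refl
  ... | tri≈ _ refl _ = u , inj₁ refl , inj₁ refl
  ... | tri> _ _ v<u = u , inj₁ refl , inj₂ (v<u , u , Fin.≤-refl , Edge-sym {G = G} e)

  decomposition : PathDecomposition G
  decomposition = record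
    { m             = n G
    ; bag           = bag
    ; covers-vertex = λ v → v , ∈-filterFin⁺ (inBag? v) (inj₁ refl)
    ; covers-edge   = λ u v e → let t , u∈t , v∈t = covers-edge u v e in
                        t , ∈-filterFin⁺ (inBag? t) u∈t , ∈-filterFin⁺ (inBag? t) v∈t
    ; contiguous    = λ v s t r s≤t t≤r v∈s v∈r → ∈-filterFin⁺ (inBag? t)
                        (InBag-contiguous s≤t t≤r (∈-filterFin⁻ (inBag? s) v∈s) (∈-filterFin⁻ (inBag? r) v∈r))
    }
    where
    bag : V → Subset (n G)
    bag t = filterFin (inBag? t)

  width≤ : ∀ k (L : V → List V) → (∀ t → length (L t) ≤ k) →
           (∀ {t u} → u Fin.< t → Active t u → u ∈ˡ L t) → WidthLe decomposition k
  width≤ k L L-length L-covers t = ℕ.≤-trans (∣p∣≤length _ (t ∷ L t) covered) (s≤s (L-length t))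
    where
    covered : ∀ {u} → u Subset.∈ PathDecomposition.bag decomposition t → u ∈ˡ t ∷ L t
    covered u∈t with ∈-filterFin⁻ (inBag? t) u∈t
    ... | inj₁ refl               = here refl
    ... | inj₂ (u<t , u-active)   = there (L-covers u<t u-active)

-- Base-m digits

module Digits (m : ℕ) .{{_ : NonZero m}} where

  private
    m^≢0 : ∀ k → NonZero (m ^ k)
    m^≢0 k = ℕ.m^n≢0 m k

  dropDigits : ℕ → ℕ → ℕ
  dropDigits k z = _/_ z (m ^ k) {{m^≢0 k}}

  digit : ℕ → ℕ → ℕ
  digit k z = dropDigits k z % m

  clearDigits : ℕ → ℕ → ℕ
  clearDigits k z = dropDigits k z * m ^ k

  digit<m : ∀ k z → digit k z < m
  digit<m k z = m%n<n (dropDigits k z) m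

  dropDigits-mono : ∀ k {a b} → a ≤ b → dropDigits k a ≤ dropDigits k b
  dropDigits-mono k = /-monoˡ-≤ (m ^ k) {{m^≢0 k}}

  dropDigits-suc : ∀ k z → dropDigits (suc k) z ≡ dropDigits k z / m
  dropDigits-suc k z = trans (/-congʳ {{m^≢0 (suc k)}} {{nz}} (ℕ.*-comm m (m ^ k)))
    (sym (m/n/o≡m/[n*o] z (m ^ k) m {{m^≢0 k}} {{_}} {{nz}}))
    where nz = ℕ.m*n≢0 (m ^ k) m {{m^≢0 k}}

  clearDigits≤ : ∀ k z → clearDigits k z ≤ z
  clearDigits≤ k z = m/n*n≤m z (m ^ k) {{m^≢0 k}}

  dropDigits-clearDigits : ∀ k z → dropDigits k (clearDigits k z) ≡ dropDigits k z
  dropDigits-clearDigits k z = m*n/n≡m (dropDigits k z) (m ^ k) {{m^≢0 k}}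

  clearDigits-squeeze : ∀ k {x y} → clearDigits k y ≤ x → x ≤ y → clearDigits k x ≡ clearDigits k y
  clearDigits-squeeze k {x} {y} start≤x x≤y = cong (_* m ^ k) (ℕ.≤-antisym (dropDigits-mono k x≤y) (begin
    dropDigits k y                   ≡⟨ dropDigits-clearDigits k y ⟨
    dropDigits k (clearDigits k y)   ≤⟨ dropDigits-mono k start≤x ⟩
    dropDigits k x                   ∎))
    where open ℕ.≤-Reasoning

  private
    %-cancel-≤ : ∀ {a b} → a ≤ b → a / m ≡ b / m → a % m ≤ b % m
    %-cancel-≤ {a} {b} a≤b a/m≡b/m = ℕ.+-cancelʳ-≤ (a / m * m) (a % m) (b % m)
      (subst₂ _≤_ (m≡m%n+[m/n]*n a m) (trans (m≡m%n+[m/n]*n b m) (cong (λ q → b % m + q * m) (sym a/m≡b/m))) a≤b)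

    %-cancel-< : ∀ {a b} → a < b → a / m ≡ b / m → a % m < b % m
    %-cancel-< {a} {b} a<b a/m≡b/m = ℕ.+-cancelʳ-< (a / m * m) (a % m) (b % m)
      (subst₂ _<_ (m≡m%n+[m/n]*n a m) (trans (m≡m%n+[m/n]*n b m) (cong (λ q → b % m + q * m) (sym a/m≡b/m))) a<b)

  digit-mono : ∀ k {x y} → x ≤ y → dropDigits (suc k) x ≡ dropDigits (suc k) y → digit k x ≤ digit k y
  digit-mono k {x} {y} x≤y same = %-cancel-≤ (dropDigits-mono k x≤y)
    (trans (sym (dropDigits-suc k x)) (trans same (dropDigits-suc k y)))

  DigitLessAt : ℕ → ℕ → ℕ → Set
  DigitLessAt k x y = dropDigits (suc k) x ≡ dropDigits (suc k) y × digit k x < digit k y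

  module _ {x y : ℕ} (x<y : x < y) where

    private
      DigitLessBelow : ℕ → Set
      DigitLessBelow k = ∃[ j ] (j < k × DigitLessAt j x y)

      digitLessBelow-or-dropDigits< : ∀ k → DigitLessBelow k ⊎ dropDigits k x < dropDigits k y
      digitLessBelow-or-dropDigits< zero = inj₂ (subst₂ _<_ (sym (n/1≡n x)) (sym (n/1≡n y)) x<y)
      digitLessBelow-or-dropDigits< (suc k) with digitLessBelow-or-dropDigits< k
      ... | inj₁ (j , j<k , less) = inj₁ (j , ℕ.m<n⇒m<1+n j<k , less)
      ... | inj₂ below with dropDigits (suc k) x ℕ.≟ dropDigits (suc k) y
      ...   | yes same = inj₁ (k , ℕ.n<1+n k , same , %-cancel-< below
                (trans (sym (dropDigits-suc k x)) (trans same (dropDigits-suc k y))))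
      ...   | no differ = inj₂ (ℕ.≤∧≢⇒< (dropDigits-mono (suc k) (ℕ.<⇒≤ x<y)) differ)

    <⇒DigitLessAt : ∀ p → y < m ^ p → ∃[ k ] (k < p × DigitLessAt k x y)
    <⇒DigitLessAt p y<m^p with digitLessBelow-or-dropDigits< p
    ... | inj₁ less = less
    ... | inj₂ below = ⊥-elim (ℕ.n≮0 (subst (dropDigits p x <_) (m<n⇒m/n≡0 {{m^≢0 p}} y<m^p) below))

-- Arithmetic along arms

-- ∣ a - b ∣ ≤ L without truncated subtraction.
Gap≤ : ℕ → ℕ → ℕ → Set
Gap≤ L a b = a ≤ L + b × b ≤ L + a

Gap≤-sym : ∀ {L a b} → Gap≤ L a b → Gap≤ L b a
Gap≤-sym (a≤ , b≤) = b≤ , a≤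

-- Opaque so that the implicit arguments of its lemmas can be inferred.
opaque
  interpolate : ℕ → ℕ → ℕ → ℕ → ℕ
  interpolate a b L i = (i + a) ⊓ ((L ∸ i) + b)

  interpolate-start : ∀ {a b L} → Gap≤ L a b → interpolate a b L 0 ≡ a
  interpolate-start (a≤ , _) = ℕ.m≤n⇒m⊓n≡m a≤

  interpolate-end : ∀ {a b L} → Gap≤ L a b → interpolate a b L L ≡ b
  interpolate-end {L = L} (_ , b≤) rewrite ℕ.n∸n≡0 L = ℕ.m≥n⇒m⊓n≡n b≤

  interpolate-step : ∀ {a b L i} → i < L → Gap≤ 1 (interpolate a b L i) (interpolate a b L (suc i))
  interpolate-step {a} {b} {L} {i} i<L rewrite ℕ.+-∸-assoc 1 i<L = ⊓-step (i + a) (L ∸ suc i + b)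
    where
    ⊓-step : ∀ X Y → Gap≤ 1 (X ⊓ suc Y) (suc X ⊓ Y)
    ⊓-step X Y = ℕ.⊓-monoˡ-≤ (suc Y) (ℕ.m≤n⇒m≤1+n (ℕ.n≤1+n X)) ,
                 ℕ.⊓-monoʳ-≤ (suc X) (ℕ.m≤n⇒m≤1+n (ℕ.n≤1+n Y))

d+2d≡3d : ∀ d → d + 2 * d ≡ 3 * d
d+2d≡3d = solve-∀

gap-from-2d : ∀ d {L h} → d ≤ L → d ≤ h × h ≤ 3 * d → Gap≤ L (2 * d) h
gap-from-2d d {L} {h} d≤L (d≤h , h≤3d) =
  ℕ.≤-trans (ℕ.≤-reflexive (2d≡d+d d)) (ℕ.+-mono-≤ d≤L d≤h) ,
  ℕ.≤-trans h≤3d (ℕ.≤-trans (ℕ.≤-reflexive (sym (d+2d≡3d d))) (ℕ.+-monoˡ-≤ (2 * d) d≤L))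
  where
  2d≡d+d : ∀ d → 2 * d ≡ d + d
  2d≡d+d = solve-∀

shortcut≤4d∸1 : ∀ d {x y} → x < y → y ≤ 2 * d → (d + x) + (d + (2 * d ∸ y)) ≤ 4 * d ∸ 1
shortcut≤4d∸1 d {x} {y} x<y y≤2d = ℕ.m+n≤o⇒m≤o∸n _ (begin
  (d + x) + (d + (2 * d ∸ y)) + 1   ≡⟨ regroup d x (2 * d ∸ y) ⟩
  (d + d) + (suc x + (2 * d ∸ y))   ≤⟨ ℕ.+-monoʳ-≤ (d + d) (ℕ.+-monoˡ-≤ (2 * d ∸ y) x<y) ⟩
  (d + d) + (y + (2 * d ∸ y))       ≡⟨ cong ((d + d) +_) (ℕ.m+[n∸m]≡n y≤2d) ⟩
  (d + d) + 2 * d                   ≡⟨ d+d+2d≡4d d ⟩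
  4 * d                             ∎)
  where
  open ℕ.≤-Reasoning
  regroup : ∀ d x c → (d + x) + (d + c) + 1 ≡ (d + d) + (suc x + c)
  regroup = solve-∀
  d+d+2d≡4d : ∀ d → (d + d) + 2 * d ≡ 4 * d
  d+d+2d≡4d = solve-∀

-- The construction

data Side : Set where
  b-side a-side : Side

_≟ˢ_ : (s s′ : Side) → Dec (s ≡ s′)
b-side ≟ˢ b-side = yes refl
a-side ≟ˢ a-side = yes refl
b-side ≟ˢ a-side = no λ ()
a-side ≟ˢ b-side = no λ ()

module Construction (d p : ℕ) .{{_ : NonZero d}} where

  m : ℕ
  m = suc (2 * d)

  open Digits m using (dropDigits; digit; clearDigits; DigitLessAt; digit<m; digit-mono; clearDigits≤;
                      clearDigits-squeeze; dropDigits-clearDigits; <⇒DigitLessAt)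

  N S SB K : ℕ
  N  = m ^ p
  S  = 3 * d
  SB = suc (p * S)
  K  = p + (SB + SB)

  data Loc : Set where
    hub   : Fin p → Loc
    end   : Side → Loc
    inner : Side → Fin p → Fin S → Loc

  slotAt : Side → Fin SB → Loc
  slotAt s Fin.zero    = end s
  slotAt s (Fin.suc c) = uncurry (inner s) (Fin.remQuot S c)

  locAt : Fin K → Loc
  locAt ι with Fin.splitAt p ι
  ... | inj₁ j = hub j
  ... | inj₂ κ with Fin.splitAt SB κ
  ...   | inj₁ c = slotAt b-side c
  ...   | inj₂ c = slotAt a-side c

  sideIndex : Side → Fin SB → Fin (SB + SB)
  sideIndex b-side c = c Fin.↑ˡ SB
  sideIndex a-side c = SB Fin.↑ʳ c

  slotIndex : Side → Fin SB → Fin K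
  slotIndex s c = p Fin.↑ʳ sideIndex s c

  -- The locations of one integer are numbered hubs first, then the b-side end and its inner
  -- arm vertices, then the a-side likewise; vertex (y , ℓ) gets number K * y + rank ℓ.
  locIndex : Loc → Fin K
  locIndex (hub j)       = j Fin.↑ˡ (SB + SB)
  locIndex (end s)       = slotIndex s Fin.zero
  locIndex (inner s j r) = slotIndex s (Fin.suc (Fin.combine j r))

  locAt-slotIndex : ∀ s c → locAt (slotIndex s c) ≡ slotAt s c
  locAt-slotIndex b-side c rewrite Fin.splitAt-↑ʳ p (SB + SB) (c Fin.↑ˡ SB) | Fin.splitAt-↑ˡ SB c SB = refl
  locAt-slotIndex a-side c rewrite Fin.splitAt-↑ʳ p (SB + SB) (SB Fin.↑ʳ c) | Fin.splitAt-↑ʳ SB SB c = refl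

  locAt-locIndex : ∀ ℓ → locAt (locIndex ℓ) ≡ ℓ
  locAt-locIndex (hub j) rewrite Fin.splitAt-↑ˡ p j (SB + SB) = refl
  locAt-locIndex (end s) = locAt-slotIndex s Fin.zero
  locAt-locIndex (inner s j r) =
    trans (locAt-slotIndex s _) (cong (uncurry (inner s)) (Fin.remQuot-combine j r))

  slotIndex-slotAt : ∀ s c → locIndex (slotAt s c) ≡ slotIndex s c
  slotIndex-slotAt s Fin.zero    = refl
  slotIndex-slotAt s (Fin.suc c) = cong (slotIndex s ∘ Fin.suc) (Fin.combine-remQuot {p} S c)

  locIndex-locAt : ∀ ι → locIndex (locAt ι) ≡ ι
  locIndex-locAt ι with Fin.splitAt p ι in split₁
  ... | inj₁ j = Fin.splitAt⁻¹-↑ˡ split₁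
  ... | inj₂ κ with Fin.splitAt SB κ in split₂
  ...   | inj₁ c = trans (slotIndex-slotAt b-side c)
                      (trans (cong (p Fin.↑ʳ_) (Fin.splitAt⁻¹-↑ˡ split₂)) (Fin.splitAt⁻¹-↑ʳ split₁))
  ...   | inj₂ c = trans (slotIndex-slotAt a-side c)
                      (trans (cong (p Fin.↑ʳ_) (Fin.splitAt⁻¹-↑ʳ split₂)) (Fin.splitAt⁻¹-↑ʳ split₁))

  rank : Loc → ℕ
  rank ℓ = toℕ (locIndex ℓ)

  sideOffset : Side → ℕ
  sideOffset b-side = 0
  sideOffset a-side = SB

  toℕ-slotIndex : ∀ s c → toℕ (slotIndex s c) ≡ p + (sideOffset s + toℕ c)
  toℕ-slotIndex b-side c = trans (Fin.toℕ-↑ʳ p _) (cong (p +_) (Fin.toℕ-↑ˡ c SB))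
  toℕ-slotIndex a-side c = trans (Fin.toℕ-↑ʳ p _) (cong (p +_) (Fin.toℕ-↑ʳ SB c))

  rank-hub<p : ∀ j → rank (hub j) < p
  rank-hub<p j = subst (_< p) (sym (Fin.toℕ-↑ˡ j _)) (Fin.toℕ<n j)

  p≤toℕ-slotIndex : ∀ s c → p ≤ toℕ (slotIndex s c)
  p≤toℕ-slotIndex s c = subst (p ≤_) (sym (toℕ-slotIndex s c)) (ℕ.m≤m+n p _)

  rank-end<rank-inner : ∀ s j r → rank (end s) < rank (inner s j r)
  rank-end<rank-inner s j r = subst₂ _<_ (sym (toℕ-slotIndex s _)) (sym (toℕ-slotIndex s _))
    (ℕ.+-monoʳ-< p (ℕ.+-monoʳ-< (sideOffset s) (s≤s z≤n)))

  rank-inner-suc : ∀ s j {r r′ : Fin S} → toℕ r′ ≡ suc (toℕ r) →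
                   rank (inner s j r′) ≡ suc (rank (inner s j r))
  rank-inner-suc s j {r} {r′} r′≡1+r = begin
    rank (inner s j r′)                   ≡⟨ toℕ-slotIndex s _ ⟩
    p + (sideOffset s + suc c′)           ≡⟨ cong (λ c → p + (sideOffset s + suc c)) c′≡1+c ⟩
    p + (sideOffset s + suc (suc c))      ≡⟨ cong (p +_) (ℕ.+-suc (sideOffset s) _) ⟩
    p + suc (sideOffset s + suc c)        ≡⟨ ℕ.+-suc p _ ⟩
    suc (p + (sideOffset s + suc c))      ≡⟨ cong suc (toℕ-slotIndex s _) ⟨
    suc (rank (inner s j r))              ∎
    where
    open ≡-Reasoning
    c = toℕ (Fin.combine j r)
    c′ = toℕ (Fin.combine j r′)
    c′≡1+c : c′ ≡ suc c
    c′≡1+c = trans (Fin.toℕ-combine j r′) (trans (cong (S * toℕ j +_) r′≡1+r)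
               (trans (ℕ.+-suc (S * toℕ j) (toℕ r)) (cong suc (sym (Fin.toℕ-combine j r)))))

  sideOf : Loc → Side
  sideOf ℓ with rank ℓ ℕ.<? p + SB
  ... | yes _ = b-side
  ... | no _  = a-side

  sideOf-between : ∀ {s j r ℓ} → rank (end s) < rank ℓ → rank ℓ ≤ rank (inner s j r) → sideOf ℓ ≡ s
  sideOf-between {b-side} {j} {r} {ℓ} _ ℓ≤inner with rank ℓ ℕ.<? p + SB
  ... | yes _ = refl
  ... | no ℓ≮ = ⊥-elim (ℓ≮ (ℕ.≤-<-trans ℓ≤inner (subst (_< p + SB) (sym (toℕ-slotIndex b-side _))
                  (ℕ.+-monoʳ-< p (Fin.toℕ<n (Fin.suc (Fin.combine j r)))))))
  sideOf-between {a-side} {ℓ = ℓ} end<ℓ _ with rank ℓ ℕ.<? p + SB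
  ... | yes ℓ< = ⊥-elim (ℕ.<-asym ℓ< (subst (_< rank ℓ)
                  (trans (toℕ-slotIndex a-side _) (cong (p +_) (ℕ.+-identityʳ SB))) end<ℓ))
  ... | no _ = refl

  Vertex : Set
  Vertex = Fin N × Loc

  decode : Fin (N * K) → Vertex
  decode u = Data.Product.map₂ locAt (Fin.remQuot {N} K u)

  -- Opaque so that the implicit arguments of its lemmas can be inferred.
  opaque
    encode : Vertex → Fin (N * K)
    encode (y , ℓ) = Fin.combine y (locIndex ℓ)

    decode-encode : ∀ v → decode (encode v) ≡ v
    decode-encode (y , ℓ) = trans (cong (Data.Product.map₂ locAt) (Fin.remQuot-combine y (locIndex ℓ)))
                                  (cong (y ,_) (locAt-locIndex ℓ))

    encode-decode : ∀ u → encode (decode u) ≡ u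
    encode-decode u =
      trans (cong (Fin.combine y) (locIndex-locAt ι)) (Fin.combine-remQuot {N} K u)
      where
      y : Fin N
      y = proj₁ (Fin.remQuot K u)
      ι : Fin K
      ι = proj₂ (Fin.remQuot {N} K u)

    encode-injective : ∀ {v w} → encode v ≡ encode w → v ≡ w
    encode-injective {v} {w} eq = trans (sym (decode-encode v)) (trans (cong decode eq) (decode-encode w))

    position : Vertex → ℕ
    position v = toℕ (encode v)

    toℕ-encode : ∀ v → toℕ (encode v) ≡ position v
    toℕ-encode v = refl

    position-decode : ∀ u → position (decode u) ≡ toℕ u
    position-decode u = cong toℕ (encode-decode u)

    position-< : ∀ {z y : Fin N} {ℓ ℓ′} → toℕ z ≤ toℕ y → rank ℓ < rank ℓ′ →
                 position (z , ℓ) < position (y , ℓ′)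
    position-< {z} {y} {ℓ} {ℓ′} z≤y ℓ<ℓ′ = begin-strict
      position (z , ℓ)        ≡⟨ Fin.toℕ-combine z (locIndex ℓ) ⟩
      K * toℕ z + rank ℓ      <⟨ ℕ.+-mono-≤-< (ℕ.*-monoʳ-≤ K z≤y) ℓ<ℓ′ ⟩
      K * toℕ y + rank ℓ′     ≡⟨ Fin.toℕ-combine y (locIndex ℓ′) ⟨
      position (y , ℓ′)       ∎
      where open ℕ.≤-Reasoning

    position-cancel-< : ∀ {y : Fin N} {ℓ ℓ′} → position (y , ℓ) < position (y , ℓ′) → rank ℓ < rank ℓ′
    position-cancel-< {y} {ℓ} {ℓ′} lt = ℕ.+-cancelˡ-< (K * toℕ y) _ _
      (subst₂ _<_ (Fin.toℕ-combine y (locIndex ℓ)) (Fin.toℕ-combine y (locIndex ℓ′)) lt)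

    position-cancel-≤ : ∀ {y : Fin N} {ℓ ℓ′} → position (y , ℓ) ≤ position (y , ℓ′) → rank ℓ ≤ rank ℓ′
    position-cancel-≤ {y} {ℓ} {ℓ′} le = ℕ.+-cancelˡ-≤ (K * toℕ y) _ _
      (subst₂ _≤_ (Fin.toℕ-combine y (locIndex ℓ)) (Fin.toℕ-combine y (locIndex ℓ′)) le)

    position-index-mono : ∀ {z y : Fin N} {ℓ ℓ′} → position (z , ℓ) ≤ position (y , ℓ′) → toℕ z ≤ toℕ y
    position-index-mono {ℓ = ℓ} {ℓ′} le =
      ℕ.≮⇒≥ λ y<z → ℕ.<⇒≱ (Fin.combine-monoˡ-< (locIndex ℓ′) (locIndex ℓ) y<z) le

    position-inner-suc : ∀ {y s j} {r r′ : Fin S} → toℕ r′ ≡ suc (toℕ r) →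
                         position (y , inner s j r′) ≡ suc (position (y , inner s j r))
    position-inner-suc {y} {s} {j} {r} {r′} r′≡1+r = begin
      position (y , inner s j r′)            ≡⟨ Fin.toℕ-combine y _ ⟩
      K * toℕ y + rank (inner s j r′)        ≡⟨ cong (K * toℕ y +_) (rank-inner-suc s j r′≡1+r) ⟩
      K * toℕ y + suc (rank (inner s j r))   ≡⟨ ℕ.+-suc (K * toℕ y) _ ⟩
      suc (K * toℕ y + rank (inner s j r))   ≡⟨ cong suc (Fin.toℕ-combine y _) ⟨
      suc (position (y , inner s j r))       ∎
      where open ≡-Reasoning

  digitAt : Fin p → Fin N → ℕ
  digitAt j y = digit (toℕ j) (toℕ y)

  blockAt : Fin p → Fin N → ℕ
  blockAt j y = dropDigits (suc (toℕ j)) (toℕ y)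

  digitAt≤2d : ∀ j y → digitAt j y ≤ 2 * d
  digitAt≤2d j y = ℕ.m<1+n⇒m≤n (digit<m (toℕ j) (toℕ y))

  -- The level-j hub of the block of y, the integers agreeing with y above digit j, is placed
  -- at the first integer of the block, so it precedes every integer whose arms end there.
  hubIndex : Fin p → Fin N → Fin N
  hubIndex j y = Fin.fromℕ< (ℕ.≤-<-trans (clearDigits≤ (suc (toℕ j)) (toℕ y)) (Fin.toℕ<n y))

  toℕ-hubIndex : ∀ j y → toℕ (hubIndex j y) ≡ clearDigits (suc (toℕ j)) (toℕ y)
  toℕ-hubIndex j y = Fin.toℕ-fromℕ< _

  hubIndex≤ : ∀ j y → toℕ (hubIndex j y) ≤ toℕ y
  hubIndex≤ j y = subst (_≤ toℕ y) (sym (toℕ-hubIndex j y)) (clearDigits≤ (suc (toℕ j)) (toℕ y))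

  hubIndex-squeeze : ∀ j {x y} → toℕ (hubIndex j y) ≤ toℕ x → toℕ x ≤ toℕ y → hubIndex j x ≡ hubIndex j y
  hubIndex-squeeze j {x} {y} hub≤x x≤y = Fin.toℕ-injective (begin
    toℕ (hubIndex j x)                  ≡⟨ toℕ-hubIndex j x ⟩
    clearDigits (suc (toℕ j)) (toℕ x)   ≡⟨ clearDigits-squeeze (suc (toℕ j))
                                             (subst (_≤ toℕ x) (toℕ-hubIndex j y) hub≤x) x≤y ⟩
    clearDigits (suc (toℕ j)) (toℕ y)   ≡⟨ toℕ-hubIndex j y ⟨
    toℕ (hubIndex j y)                  ∎)
    where open ≡-Reasoning

  blockAt-hubIndex : ∀ j y → blockAt j (hubIndex j y) ≡ blockAt j y
  blockAt-hubIndex j y = trans (cong (dropDigits (suc (toℕ j))) (toℕ-hubIndex j y))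
                               (dropDigits-clearDigits (suc (toℕ j)) (toℕ y))

  armLength : Fin N → Side → Fin p → ℕ
  armLength y b-side j = d + digitAt j y
  armLength y a-side j = d + (2 * d ∸ digitAt j y)

  d≤armLength : ∀ y s j → d ≤ armLength y s j
  d≤armLength y b-side j = ℕ.m≤m+n d _
  d≤armLength y a-side j = ℕ.m≤m+n d _

  armLength≤3d : ∀ y s j → armLength y s j ≤ 3 * d
  armLength≤3d y b-side j = ℕ.≤-trans (ℕ.+-monoʳ-≤ d (digitAt≤2d j y)) (ℕ.≤-reflexive (d+2d≡3d d))
  armLength≤3d y a-side j =
    ℕ.≤-trans (ℕ.+-monoʳ-≤ d (ℕ.m∸n≤m (2 * d) (digitAt j y))) (ℕ.≤-reflexive (d+2d≡3d d))

  -- The level-j arm of (y , s) is the path end s, inner s j 0, …, inner s j (L - 2), hub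
  -- of length L = armLength y s j.
  data Adj : Vertex → Vertex → Set where
    arm-start  : ∀ {y s j r} → toℕ r ≡ 0 → 2 ≤ armLength y s j → Adj (y , end s) (y , inner s j r)
    arm-step   : ∀ {y s j r r′} → toℕ r′ ≡ suc (toℕ r) → 3 + toℕ r ≤ armLength y s j →
                 Adj (y , inner s j r) (y , inner s j r′)
    arm-finish : ∀ {y s j r} → 2 + toℕ r ≡ armLength y s j → Adj (hubIndex j y , hub j) (y , inner s j r)
    arm-direct : ∀ {y s j} → armLength y s j ≡ 1 → Adj (hubIndex j y , hub j) (y , end s)

  adj? : ∀ a b → Dec (Adj a b)
  adj? (y , end s) (y′ , inner s′ j r) =
    map′ (λ { (refl , refl , r≡0 , 2≤) → arm-start r≡0 2≤ })
         (λ { (arm-start r≡0 2≤) → refl , refl , r≡0 , 2≤ })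
      (y Fin.≟ y′ ×-dec s ≟ˢ s′ ×-dec toℕ r ℕ.≟ 0 ×-dec 2 ℕ.≤? armLength y s j)
  adj? (y , inner s j r) (y′ , inner s′ j′ r′) =
    map′ (λ { (refl , refl , refl , r′≡ , 3≤) → arm-step r′≡ 3≤ })
         (λ { (arm-step r′≡ 3≤) → refl , refl , refl , r′≡ , 3≤ })
      (y Fin.≟ y′ ×-dec s ≟ˢ s′ ×-dec j Fin.≟ j′ ×-dec
       toℕ r′ ℕ.≟ suc (toℕ r) ×-dec 3 + toℕ r ℕ.≤? armLength y s j)
  adj? (z , hub j) (y , inner s j′ r) =
    map′ (λ { (refl , refl , ≡L) → arm-finish ≡L }) (λ { (arm-finish ≡L) → refl , refl , ≡L })
      (j Fin.≟ j′ ×-dec z Fin.≟ hubIndex j y ×-dec 2 + toℕ r ℕ.≟ armLength y s j)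
  adj? (z , hub j) (y , end s) =
    map′ (λ { (refl , ≡1) → arm-direct ≡1 }) (λ { (arm-direct ≡1) → refl , ≡1 })
      (z Fin.≟ hubIndex j y ×-dec armLength y s j ℕ.≟ 1)
  adj? (_ , hub _)       (_ , hub _)       = no λ ()
  adj? (_ , end _)       (_ , hub _)       = no λ ()
  adj? (_ , end _)       (_ , end _)       = no λ ()
  adj? (_ , inner _ _ _) (_ , hub _)       = no λ ()
  adj? (_ , inner _ _ _) (_ , end _)       = no λ ()

  Adj-irreflexive : ∀ a → ¬ Adj a a
  Adj-irreflexive _ (arm-step r≡1+r _) = ℕ.1+n≢n (sym r≡1+r)

  open RelationGraph decode Adj adj? Adj-irreflexive public using (graph; Linked; Edge⇒Linked; Linked⇒Edge)

  Adj⇒Edge : ∀ {a b} → Adj a b → Edge graph (encode a) (encode b)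
  Adj⇒Edge {a} {b} a~b = Linked⇒Edge (inj₁ (subst₂ Adj (sym (decode-encode a)) (sym (decode-encode b)) a~b))

  Adj⇒Edge˘ : ∀ {a b} → Adj a b → Edge graph (encode b) (encode a)
  Adj⇒Edge˘ {a} {b} a~b = Linked⇒Edge (inj₂ (subst₂ Adj (sym (decode-encode a)) (sym (decode-encode b)) a~b))

  Adj⇒position< : ∀ {a b} → Adj a b → position a < position b
  Adj⇒position< (arm-start {s = s} {j} {r} _ _) = position-< ℕ.≤-refl (rank-end<rank-inner s j r)
  Adj⇒position< (arm-step r′≡1+r _) = ℕ.≤-reflexive (sym (position-inner-suc r′≡1+r))
  Adj⇒position< (arm-finish {y} {s} {j} _) =
    position-< (hubIndex≤ j y) (ℕ.<-≤-trans (rank-hub<p j) (p≤toℕ-slotIndex s _))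
  Adj⇒position< (arm-direct {y} {s} {j} _) =
    position-< (hubIndex≤ j y) (ℕ.<-≤-trans (rank-hub<p j) (p≤toℕ-slotIndex s _))

  hubsAt : Fin N → List (Fin (N * K))
  hubsAt x = map (λ j → encode (hubIndex j x , hub j)) (allFin p)

  -- The earlier vertices that may have a neighbour at or after t: the p hubs of the blocks
  -- of x, the end whose arms are being traversed at t, and the predecessor of t.
  separatorList : Fin (N * K) → List (Fin (N * K))
  separatorList t = hubsAt x ++ encode (x , end (sideOf ℓ)) ∷ Fin.pred t ∷ []
    where
    x = proj₁ (decode t)
    ℓ = proj₂ (decode t)

  length-separatorList : ∀ t → length (separatorList t) ≡ p + 2
  length-separatorList t = trans (List.length-++ (hubsAt _))
    (cong (_+ 2) (trans (List.length-map _ (allFin p)) (List.length-tabulate _)))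

  hub∈separatorList : ∀ t j {y ℓ} → position (hubIndex j y , hub j) < toℕ t → toℕ t ≤ position (y , ℓ) →
                      encode (hubIndex j y , hub j) ∈ˡ separatorList t
  hub∈separatorList t j {y} hub<t t≤y = ∈-++⁺ˡ (subst (_∈ˡ hubsAt x) (cong (λ z → encode (z , hub j)) hubₓ≡hubᵧ)
    (∈-map⁺ (λ j → encode (hubIndex j x , hub j)) (∈-allFin j)))
    where
    x = proj₁ (decode t)
    hubₓ≡hubᵧ : hubIndex j x ≡ hubIndex j y
    hubₓ≡hubᵧ = hubIndex-squeeze j (position-index-mono (ℕ.<⇒≤ (subst (_ <_) (sym (position-decode t)) hub<t)))
                                   (position-index-mono (subst (_≤ _) (sym (position-decode t)) t≤y))

  Adj⇒∈separatorList : ∀ {a b} t → Adj a b → position a < toℕ t → toℕ t ≤ position b →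
                       encode a ∈ˡ separatorList t
  Adj⇒∈separatorList t (arm-start {y} {s} {j} {r} _ _) end<t t≤inner =
    ∈-++⁺ʳ (hubsAt x) (here (cong₂ (λ z s → encode (z , end s)) y≡x (sym sideOf-ℓ)))
    where
    x = proj₁ (decode t)
    ℓ = proj₂ (decode t)
    end<xℓ : position (y , end s) < position (x , ℓ)
    end<xℓ = subst (_ <_) (sym (position-decode t)) end<t
    xℓ≤inner : position (x , ℓ) ≤ position (y , inner s j r)
    xℓ≤inner = subst (_≤ _) (sym (position-decode t)) t≤inner
    y≡x : y ≡ x
    y≡x = Fin.toℕ-injective (ℕ.≤-antisym (position-index-mono (ℕ.<⇒≤ end<xℓ)) (position-index-mono xℓ≤inner))
    sideOf-ℓ : sideOf ℓ ≡ s
    sideOf-ℓ = sideOf-between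
      (position-cancel-< (subst (λ z → position (z , end s) < position (x , ℓ)) y≡x end<xℓ))
      (position-cancel-≤ (subst (λ z → position (x , ℓ) ≤ position (z , inner s j r)) y≡x xℓ≤inner))
  Adj⇒∈separatorList t (arm-step r′≡1+r _) inner<t t≤inner′ =
    ∈-++⁺ʳ (hubsAt _) (there (here (toℕ-suc⇒≡pred (trans (cong suc (toℕ-encode _))
      (ℕ.≤-antisym inner<t (ℕ.≤-trans t≤inner′ (ℕ.≤-reflexive (position-inner-suc r′≡1+r))))))))
  Adj⇒∈separatorList t (arm-finish {j = j} _) hub<t t≤y = hub∈separatorList t j hub<t t≤y
  Adj⇒∈separatorList t (arm-direct {j = j} _) hub<t t≤y = hub∈separatorList t j hub<t t≤y

  pathwidth≤p+2 : PathwidthLe graph (p + 2)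
  pathwidth≤p+2 = decomposition , width≤ (p + 2) separatorList (ℕ.≤-reflexive ∘ length-separatorList) earlier-active
    where
    open VertexSeparation graph
    earlier-active : ∀ {t u} → u Fin.< t → Active t u → u ∈ˡ separatorList t
    earlier-active {t} {u} u<t (w , t≤w , u~w) = linked∈ (Edge⇒Linked u~w)
      (subst (_< toℕ t) (sym (position-decode u)) u<t) (subst (toℕ t ≤_) (sym (position-decode w)) t≤w)
      where
      linked∈ : Linked (decode u) (decode w) → position (decode u) < toℕ t → toℕ t ≤ position (decode w) →
                u ∈ˡ separatorList t
      linked∈ (inj₁ u≺w) u<t t≤w = subst (_∈ˡ separatorList t) (encode-decode u) (Adj⇒∈separatorList t u≺w u<t t≤w)
      linked∈ (inj₂ w≺u) u<t t≤w = ⊥-elim (ℕ.<⇒≱ (Adj⇒position< w≺u) (ℕ.<⇒≤ (ℕ.<-≤-trans u<t t≤w)))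

  innerWalk : ∀ {y s j} e (r : Fin S) → 2 + toℕ r + e ≡ armLength y s j →
              Walk graph (encode (y , inner s j r)) (encode (hubIndex j y , hub j)) (suc e)
  innerWalk zero r 2+r+0≡L = step (Adj⇒Edge˘ (arm-finish (trans (sym (ℕ.+-identityʳ _)) 2+r+0≡L))) here
  innerWalk {y} {s} {j} (suc e) r 2+r+1+e≡L =
    step (Adj⇒Edge (arm-step (Fin.toℕ-fromℕ< 1+r<S) 3+r≤L))
         (innerWalk e (Fin.fromℕ< 1+r<S) (trans (cong (λ i → 2 + i + e) (Fin.toℕ-fromℕ< 1+r<S)) 3+r+e≡L))
    where
    3+r+e≡L : 3 + toℕ r + e ≡ armLength y s j
    3+r+e≡L = trans (sym (ℕ.+-suc (2 + toℕ r) e)) 2+r+1+e≡L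
    3+r≤L : 3 + toℕ r ≤ armLength y s j
    3+r≤L = ℕ.≤-trans (ℕ.m≤m+n (3 + toℕ r) e) (ℕ.≤-reflexive 3+r+e≡L)
    1+r<S : suc (toℕ r) < S
    1+r<S = ℕ.≤-trans (ℕ.n≤1+n _) (ℕ.≤-trans 3+r≤L (armLength≤3d y s j))

  armWalk : ∀ y s j → Walk graph (encode (y , end s)) (encode (hubIndex j y , hub j)) (armLength y s j)
  armWalk y s j with armLength y s j in L≡ | d≤armLength y s j
  ... | zero        | d≤0 = ⊥-elim (ℕ.<⇒≱ (>-nonZero⁻¹ d) d≤0)
  ... | suc zero    | _   = step (Adj⇒Edge˘ (arm-direct L≡)) here
  ... | suc (suc e) | _   =
    step (Adj⇒Edge (arm-start (Fin.toℕ-fromℕ< 0<S) (subst (2 ≤_) (sym L≡) (s≤s (s≤s z≤n)))))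
         (innerWalk e (Fin.fromℕ< 0<S) (trans (cong (λ i → 2 + i + e) (Fin.toℕ-fromℕ< 0<S)) (sym L≡)))
    where
    0<S : 0 < S
    0<S = ℕ.≤-trans (s≤s z≤n) (ℕ.≤-trans (ℕ.≤-reflexive (sym L≡)) (armLength≤3d y s j))

  module Potential (x : Fin N) where

    -- End and hub values are chosen so that along every arm they differ by at most its
    -- length (arm-gap); inner arm vertices interpolate between them.
    endValue : Fin N → Side → ℕ
    endValue y b-side with y Fin.≟ x
    ... | yes _ = 0
    ... | no _  = 2 * d
    endValue y a-side with toℕ y ℕ.≤? toℕ x
    ... | yes _ = 4 * d
    ... | no _  = 2 * d

    blockValue : Fin p → ℕ → ℕ
    blockValue j β with β ℕ.≟ blockAt j x
    ... | yes _ = d + digitAt j x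
    ... | no _  = 3 * d

    φ : Vertex → ℕ
    φ (z , hub j)       = blockValue j (blockAt j z)
    φ (y , end s)       = endValue y s
    φ (y , inner s j r) = interpolate (endValue y s) (blockValue j (blockAt j y)) (armLength y s j) (suc (toℕ r))

    blockValue-bounds : ∀ j β → d ≤ blockValue j β × blockValue j β ≤ 3 * d
    blockValue-bounds j β with β ℕ.≟ blockAt j x
    ... | yes _ = ℕ.m≤m+n d _ , ℕ.≤-trans (ℕ.+-monoʳ-≤ d (digitAt≤2d j x)) (ℕ.≤-reflexive (d+2d≡3d d))
    ... | no _  = ℕ.≤-trans (ℕ.m≤m+n d _) (ℕ.≤-reflexive (d+2d≡3d d)) , ℕ.≤-refl

    arm-gap : ∀ y s j → Gap≤ (armLength y s j) (endValue y s) (blockValue j (blockAt j y))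
    arm-gap y b-side j with y Fin.≟ x
    arm-gap y b-side j | yes refl with blockAt j y ℕ.≟ blockAt j y
    ... | yes _ = z≤n , ℕ.m≤m+n (armLength y b-side j) 0
    ... | no ≢  = ⊥-elim (≢ refl)
    arm-gap y b-side j | no _ = gap-from-2d d (d≤armLength y b-side j) (blockValue-bounds j (blockAt j y))
    arm-gap y a-side j with toℕ y ℕ.≤? toℕ x
    ... | no _ = gap-from-2d d (d≤armLength y a-side j) (blockValue-bounds j (blockAt j y))
    ... | yes y≤x = far , ℕ.≤-trans (proj₂ (blockValue-bounds j (blockAt j y)))
                                    (ℕ.≤-trans 3d≤4d (ℕ.m≤n+m (4 * d) (armLength y a-side j)))
      where
      3d≤4d : 3 * d ≤ 4 * d
      3d≤4d = ℕ.*-monoˡ-≤ d (ℕ.n≤1+n 3)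
      far : 4 * d ≤ armLength y a-side j + blockValue j (blockAt j y)
      far with blockAt j y ℕ.≟ blockAt j x
      ... | yes same = begin
        4 * d                              ≡⟨ 4d≡d+d+2d d ⟩
        (d + d) + 2 * d                    ≡⟨ cong ((d + d) +_) (ℕ.m+[n∸m]≡n (digitAt≤2d j y)) ⟨
        (d + d) + (dʸ + (2 * d ∸ dʸ))      ≡⟨ regroup d (2 * d ∸ dʸ) dʸ ⟩
        (d + (2 * d ∸ dʸ)) + (d + dʸ)      ≤⟨ ℕ.+-monoʳ-≤ (d + (2 * d ∸ dʸ)) (ℕ.+-monoʳ-≤ d dʸ≤dˣ) ⟩
        (d + (2 * d ∸ dʸ)) + (d + digitAt j x) ∎
        where
        open ℕ.≤-Reasoning
        dʸ = digitAt j y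
        dʸ≤dˣ : dʸ ≤ digitAt j x
        dʸ≤dˣ = digit-mono (toℕ j) y≤x same
        4d≡d+d+2d : ∀ d → 4 * d ≡ (d + d) + 2 * d
        4d≡d+d+2d = solve-∀
        regroup : ∀ d c e → (d + d) + (e + c) ≡ (d + c) + (d + e)
        regroup = solve-∀
      ... | no _ = ℕ.≤-trans (ℕ.≤-reflexive (4d≡d+3d d)) (ℕ.+-monoˡ-≤ (3 * d) (d≤armLength y a-side j))
        where
        4d≡d+3d : ∀ d → 4 * d ≡ d + 3 * d
        4d≡d+3d = solve-∀

    φ-step : ∀ {a b} → Adj a b → Gap≤ 1 (φ a) (φ b)
    φ-step (arm-start {y} {s} {j} r≡0 2≤L) rewrite r≡0 =
      subst (λ v → Gap≤ 1 v (interpolate e h L 1)) (interpolate-start (arm-gap y s j)) (interpolate-step (ℕ.<⇒≤ 2≤L))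
      where
      e = endValue y s
      h = blockValue j (blockAt j y)
      L = armLength y s j
    φ-step (arm-step r′≡1+r 3+r≤L) rewrite r′≡1+r = interpolate-step (ℕ.<⇒≤ 3+r≤L)
    φ-step (arm-finish {y} {s} {j} {r} 2+r≡L) rewrite blockAt-hubIndex j y = Gap≤-sym
      (subst (Gap≤ 1 (interpolate e h L (suc (toℕ r))))
        (trans (cong (interpolate e h L) 2+r≡L) (interpolate-end (arm-gap y s j)))
        (interpolate-step (ℕ.≤-reflexive 2+r≡L)))
      where
      e = endValue y s
      h = blockValue j (blockAt j y)
      L = armLength y s j
    φ-step (arm-direct {y} {s} {j} L≡1) rewrite blockAt-hubIndex j y =
      Gap≤-sym (subst (λ L → Gap≤ L (endValue y s) (blockValue j (blockAt j y))) L≡1 (arm-gap y s j))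

    ψ : Fin (N * K) → ℕ
    ψ u = φ (decode u)

    ψ-lipschitz : Lipschitz graph ψ
    ψ-lipschitz u w u~w with Edge⇒Linked u~w
    ... | inj₁ u≺w = proj₂ (φ-step u≺w)
    ... | inj₂ w≺u = proj₁ (φ-step w≺u)

    ψ-b≡0 : ψ (encode (x , end b-side)) ≡ 0
    ψ-b≡0 rewrite decode-encode (x , end b-side) with x Fin.≟ x
    ... | yes _ = refl
    ... | no ≢  = ⊥-elim (≢ refl)

    ψ-a≡4d : ∀ {k} → toℕ k ≤ toℕ x → ψ (encode (k , end a-side)) ≡ 4 * d
    ψ-a≡4d {k} k≤x rewrite decode-encode (k , end a-side) with toℕ k ℕ.≤? toℕ x
    ... | yes _ = refl
    ... | no k≰x = ⊥-elim (k≰x k≤x)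

  <⇒splitting-level : ∀ {i k : Fin N} → i Fin.< k → ∃[ j ] (blockAt j i ≡ blockAt j k × digitAt j i < digitAt j k)
  <⇒splitting-level {i} {k} i<k with <⇒DigitLessAt i<k p (Fin.toℕ<n k)
  ... | level , level<p , less =
    Fin.fromℕ< level<p , subst (λ l → DigitLessAt l (toℕ i) (toℕ k)) (sym (Fin.toℕ-fromℕ< level<p)) less

  blockAt-≡⇒hubIndex-≡ : ∀ j {y z} → blockAt j y ≡ blockAt j z → hubIndex j y ≡ hubIndex j z
  blockAt-≡⇒hubIndex-≡ j {y} {z} same = Fin.toℕ-injective
    (trans (toℕ-hubIndex j y) (trans (cong (_* m ^ suc (toℕ j)) same) (sym (toℕ-hubIndex j z))))

  halfGraph : HalfGraph graph (4 * d ∸ 1) N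
  halfGraph = record
    { a     = λ k → encode (k , end a-side)
    ; b     = λ i → encode (i , end b-side)
    ; a-inj = cong proj₁ ∘ encode-injective
    ; b-inj = cong proj₁ ∘ encode-injective
    ; a≢b   = λ _ _ → end-a≢end-b ∘ cong proj₂ ∘ encode-injective
    ; half  = λ i k → close⇒< i k , <⇒close i k
    }
    where
    end-a≢end-b : end a-side ≢ end b-side
    end-a≢end-b ()

    close⇒< : ∀ i k → DistLe graph (4 * d ∸ 1) (encode (i , end b-side)) (encode (k , end a-side)) → i Fin.< k
    close⇒< i k close with i Fin.<? k
    ... | yes i<k = i<k
    ... | no i≮k = ⊥-elim (Lipschitz⇒¬DistLe ψ-lipschitz far close)
      where
      open Potential i
      D<4d : 4 * d ∸ 1 + 0 < 4 * d
      D<4d = subst (_< 4 * d) (sym (ℕ.+-identityʳ _))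
               (ℕ.m≤pred[n]⇒suc[m]≤n {{ℕ.m*n≢0 4 d}} (ℕ.≤-reflexive (sym (ℕ.pred[m∸n]≡m∸[1+n] (4 * d) 0))))
      far : 4 * d ∸ 1 + ψ (encode (i , end b-side)) < ψ (encode (k , end a-side))
      far = subst₂ (λ ψb ψa → 4 * d ∸ 1 + ψb < ψa) (sym ψ-b≡0) (sym (ψ-a≡4d (ℕ.≮⇒≥ i≮k))) D<4d

    <⇒close : ∀ i k → i Fin.< k → DistLe graph (4 * d ∸ 1) (encode (i , end b-side)) (encode (k , end a-side))
    <⇒close i k i<k with <⇒splitting-level i<k
    ... | j , same , less = _ , shortcut≤4d∸1 d less (digitAt≤2d j k) ,
      (armWalk i b-side j ++ʷ subst (λ z → Walk graph (encode (z , hub j)) _ _) (blockAt-≡⇒hubIndex-≡ j (sym same))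
                                   (reverseʷ (armWalk k a-side j)))

theorem3p6 : ∀ (d p : ℕ) → 1 ≤ d →
    ∃[ G ] (PathwidthLe G (p + 2) × HalfGraph G (4 * d ∸ 1) ((2 * d + 1) ^ p))
theorem3p6 d p 1≤d =
  graph , pathwidth≤p+2 , subst (HalfGraph graph (4 * d ∸ 1)) (cong (_^ p) (ℕ.+-comm 1 (2 * d))) halfGraph
  where
  instance
    d≢0 : NonZero d
    d≢0 = >-nonZero 1≤d
  open Construction d p
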